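{- For every $n\geq 1$, every Chinese staircase $t$ over $[n]$ and all $x,y\in[n]$, the equality $$C_l\big(C_r(t,x),\,y\big)=C_r\big(C_l(t,y),\,x\big)$$ holds in the set $\mathrm{ChinT}_n$ of Chinese staircases over $[n]$.
   Context: Write $[n]=\{1,\ldots,n\}$. A (Chinese) staircase over $[n]$ is a family $t$ of non-negative integers $t_{ij}$ ($1\le j<i\le n$) and $t_i$ ($1\le i\le n$); we also write $t_{ii}=t_i$ and call $t_{ij}$ the entry of row $i$ in column $j$ (row $i$ has columns $1,\ldots,i$). $\mathrm{ChinT}_n$ is the set of staircases over $[n]$. For $n\ge 2$ a staircase $t$ over $[n]$ is written $(t',R_1)$ where $t'\in\mathrm{ChinT}_{n-1}$ consists of rows $1,\ldots,n-1$ and $R_1$ is row $n$. Right insertion $C_r:\mathrm{ChinT}_n\times[n]\to\mathrm{ChinT}_n$ (by induction on $n$): if $x=n$, $C_r(t,x)$ is $t$ with $t_n$ increased by $1$. If $x<n$, let $y_1$ be the largest column index $j\in\{1,\ldots,n\}$ with $t_{nj}\ne 0$, or $y_1=x$ if row $n$ is zero. (i) If $x\ge y_1$: $C_r(t,x)=(C_r(t',x),R_1)$. (ii) If $x<y_1<n$: $C_r(t,x)=(C_r(t',y_1),R_1')$ where $R_1'$ is $R_1$ with $t_{ny_1}$ decreased by $1$ and $t_{nx}$ increased by $1$. (iii) If $x<y_1=n$: $C_r(t,x)=(t',R_1')$ where $R_1'$ is $R_1$ with $t_n$ decreased by $1$ and $t_{nx}$ increased by $1$. Left insertion $C_l:\mathrm{ChinT}_n\times[n]\to\mathrm{ChinT}_n$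 (inserting $x$ into $t$, written $C_l(t,x)$): set $y:=\lambda$ (undefined). First, for $i=1,\ldots,x-1$ in order: if row $i$ is zero do nothing; otherwise let $z$ be the smallest column index with $t_{iz}\neq 0$ and: if $y=\lambda$, then if $z<i$ decrease $t_{iz}$ by $1$, increase $t_i$ by $1$ and set $y:=z$, while if $z=i$ decrease $t_i$ by $1$ and set $y:=z$; if $y\ne\lambda$, then if $z<y$ decrease $t_{iz}$ by $1$, increase $t_{iy}$ by $1$ and set $y:=z$, while if $z\ge y$ do nothing. Second, for row $i=x$: if $y=\lambda$ increase $t_x$ by $1$, otherwise increase $t_{xy}$ by $1$. -}

module Defs where

open import Data.Nat using (ℕ; zero; suc; _∸_; _<?_)
open import Data.Nat.Properties using (_≟_)
open import Data.Fin using (Fin; toℕ)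
open import Data.Vec using (Vec; []; _∷_)
open import Data.Maybe using (Maybe; just; nothing)
open import Data.Product using (_×_; _,_)
open import Data.Unit using (⊤; tt)
open import Relation.Nullary using (yes; no)

-- A Chinese staircase over [n]: rows 1..n, row i has i entries
-- (columns 1..i; the last entry of row i is the diagonal t_i = t_ii).
-- Stair (suc m) = (t' , R) where t' : Stair m are rows 1..m and R is row m+1.
Stair : ℕ → Set
Stair zero    = ⊤
Stair (suc m) = Stair m × Vec ℕ (suc m)

-- Column indices inside a row are 0-based naturals: index c stands for column c+1.
incAt : {k : ℕ} → ℕ → Vec ℕ k → Vec ℕ k
incAt _       []       = []
incAt zero    (a ∷ v)  = suc a ∷ v
incAt (suc c) (a ∷ v)  = a ∷ incAt c v

decAt : {k : ℕ} → ℕ → Vec ℕ k → Vec ℕ k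
decAt _       []       = []
decAt zero    (a ∷ v)  = (a ∸ 1) ∷ v
decAt (suc c) (a ∷ v)  = a ∷ decAt c v

lastNZ : {k : ℕ} → Vec ℕ k → Maybe ℕ
lastNZ []      = nothing
lastNZ (a ∷ v) with lastNZ v
... | just j  = just (suc j)
... | nothing with a
...   | zero  = nothing
...   | suc _ = just zero

firstNZ : {k : ℕ} → Vec ℕ k → Maybe ℕ
firstNZ []          = nothing
firstNZ (zero ∷ v)  with firstNZ v
... | just j  = just (suc j)
... | nothing = nothing
firstNZ (suc _ ∷ v) = just zero

-- Right insertion, on 0-based column x (x stands for x+1 ∈ [n]).

Cr' : (n : ℕ) → Stair n → ℕ → Stair n
Cr' zero    t        x = t
Cr' (suc m) (t' , R) x with x ≟ m
... | yes _ = t' , incAt m R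
... | no  _ with (Data.Maybe.fromMaybe x (lastNZ R))
...   | y1 with y1 <? suc x
...     | yes _ = Cr' m t' x , R
...     | no  _ with y1 <? m
...       | yes _ = Cr' m t' y1 , incAt x (decAt y1 R)
...       | no  _ = t' , incAt x (decAt m R)

Cr : {n : ℕ} → Stair n → Fin n → Stair n
Cr {n} t x = Cr' n t (toℕ x)

rowStep : (m : ℕ) → Vec ℕ (suc m) → Maybe ℕ → Vec ℕ (suc m) × Maybe ℕ
rowStep m R y with firstNZ R
... | nothing = R , y
rowStep m R nothing | just z with z ≟ m
...   | yes _ = decAt m R , just z
...   | no  _ = incAt m (decAt z R) , just z
rowStep m R (just c) | just z with z <? c
...   | yes _ = incAt c (decAt z R) , just z
...   | no  _ = R , just c

sweep : (m : ℕ) → Stair m → Maybe ℕ → Stair m × Maybe ℕ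
sweep zero    t        y = t , y
sweep (suc m) (t' , R) y with sweep m t' y
... | t'' , y' with rowStep m R y'
...   | R' , y'' = (t'' , R') , y''

Cl' : (n : ℕ) → Stair n → ℕ → Stair n
Cl' zero    t        x = t
Cl' (suc m) (t' , R) x with x ≟ m
... | no  _ = Cl' m t' x , R
... | yes _ with sweep m t' nothing
...   | t'' , nothing  = t'' , incAt m R
...   | t'' , just c   = t'' , incAt c R

Cl : {n : ℕ} → Stair n → Fin n → Stair n
Cl {n} t x = Cl' n t (toℕ x)

{-# OPTIONS --safe #-}
-- Both insertions work one row at a time and communicate with the other rows through a
-- single number: right insertion of x acts on the last row and passes a column on to the
-- rows before it (or stops), while the sweep of left insertion runs through the rows
-- carrying its state y.  Reading "stops" and the initial state λ as +∞, right-inserting x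
-- and then sweeping is the sweep of the original staircase, except that its final state s
-- is replaced by min(s, x) while max(s, x) is right-inserted into the swept rows.  By
-- induction on the rows this reduces to a case analysis on a single row, according to the
-- positions of x, s and the first and last non-zero entries of the row; every case is an
-- identity between composites of "move one unit from column a to column b".  Left
-- insertion below the last row leaves that row alone, so there the theorem follows by
-- induction; left insertion into the last row is the sweep followed by an increment of the
-- last row, and one more row lemma of the same kind finishes the proof.
module Submission where

open import Defs
open import Data.Nat using (ℕ; zero; suc; _<_; _≤_; _≥_; _∸_; _<?_; _≤?_; _⊔_; _⊓_; z≤n; s≤s)
open import Data.Nat.Properties
open import Data.Fin using (Fin; toℕ)
open import Data.Fin.Properties using (toℕ<n)
open import Data.Vec using (Vec; []; _∷_)
open import Data.Maybe using (Maybe; just; nothing; maybe; fromMaybe)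
open import Data.Maybe.Relation.Unary.All as All using (All; just; nothing)
open import Data.Product using (_×_; _,_; ∃; proj₁; proj₂)
open import Data.Empty using (⊥-elim)
open import Function using (_∘′_)
open import Relation.Nullary using (¬_; Dec; yes; no; contradiction)
open import Relation.Binary.PropositionalEquality
open ≡-Reasoning

infixl 7 _⊓∞_
infixl 6 _⊔∞_

private
  variable
    n : ℕ

-- Rows

entry : ℕ → Vec ℕ n → ℕ
entry _       []      = 0
entry zero    (a ∷ v) = a
entry (suc i) (a ∷ v) = entry i v

NonZeroAt : ℕ → Vec ℕ n → Set
NonZeroAt i v = ¬ entry i v ≡ 0

AllZero : Vec ℕ n → Set
AllZero v = ∀ i → entry i v ≡ 0

ZerosBelow : ℕ → Vec ℕ n → Set
ZerosBelow z v = ∀ i → i < z → entry i v ≡ 0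

ZerosAbove : ℕ → Vec ℕ n → Set
ZerosAbove j v = ∀ i → j < i → entry i v ≡ 0

IsFirstNonZero : ℕ → Vec ℕ n → Set
IsFirstNonZero z v = NonZeroAt z v × ZerosBelow z v

IsLastNonZero : ℕ → Vec ℕ n → Set
IsLastNonZero j v = NonZeroAt j v × ZerosAbove j v

nonZeroAt⇒< : ∀ i (v : Vec ℕ n) → NonZeroAt i v → i < n
nonZeroAt⇒< i       []      nz = ⊥-elim (nz refl)
nonZeroAt⇒< zero    (a ∷ v) nz = s≤s z≤n
nonZeroAt⇒< (suc i) (a ∷ v) nz = s≤s (nonZeroAt⇒< i v nz)

entry-incAt-≡ : ∀ c (v : Vec ℕ n) → c < n → entry c (incAt c v) ≡ suc (entry c v)
entry-incAt-≡ zero    (a ∷ v) _         = refl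
entry-incAt-≡ (suc c) (a ∷ v) (s≤s c<n) = entry-incAt-≡ c v c<n

entry-incAt-≢ : ∀ c i (v : Vec ℕ n) → i ≢ c → entry i (incAt c v) ≡ entry i v
entry-incAt-≢ c       i       []      _   = refl
entry-incAt-≢ zero    zero    (a ∷ v) i≢c = ⊥-elim (i≢c refl)
entry-incAt-≢ zero    (suc i) (a ∷ v) _   = refl
entry-incAt-≢ (suc c) zero    (a ∷ v) _   = refl
entry-incAt-≢ (suc c) (suc i) (a ∷ v) i≢c = entry-incAt-≢ c i v (i≢c ∘′ cong suc)

entry-decAt-≢ : ∀ c i (v : Vec ℕ n) → i ≢ c → entry i (decAt c v) ≡ entry i v
entry-decAt-≢ c       i       []      _   = refl
entry-decAt-≢ zero    zero    (a ∷ v) i≢c = ⊥-elim (i≢c refl)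
entry-decAt-≢ zero    (suc i) (a ∷ v) _   = refl
entry-decAt-≢ (suc c) zero    (a ∷ v) _   = refl
entry-decAt-≢ (suc c) (suc i) (a ∷ v) i≢c = entry-decAt-≢ c i v (i≢c ∘′ cong suc)

entry-decAt-0 : ∀ c i (v : Vec ℕ n) → entry i v ≡ 0 → entry i (decAt c v) ≡ 0
entry-decAt-0 c       i       []      _  = refl
entry-decAt-0 zero    zero    (a ∷ v) eq = cong (_∸ 1) eq
entry-decAt-0 zero    (suc i) (a ∷ v) eq = eq
entry-decAt-0 (suc c) zero    (a ∷ v) eq = eq
entry-decAt-0 (suc c) (suc i) (a ∷ v) eq = entry-decAt-0 c i v eq

nonZeroAt-incAt : ∀ c i (v : Vec ℕ n) → NonZeroAt i v → NonZeroAt i (incAt c v)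
nonZeroAt-incAt c       i       []      nz = nz
nonZeroAt-incAt zero    zero    (a ∷ v) nz = λ ()
nonZeroAt-incAt zero    (suc i) (a ∷ v) nz = nz
nonZeroAt-incAt (suc c) zero    (a ∷ v) nz = nz
nonZeroAt-incAt (suc c) (suc i) (a ∷ v) nz = nonZeroAt-incAt c i v nz

nonZeroAt-incAt-self : ∀ c (v : Vec ℕ n) → c < n → NonZeroAt c (incAt c v)
nonZeroAt-incAt-self c v c<n eq with trans (sym (entry-incAt-≡ c v c<n)) eq
... | ()

nonZeroAt-decAt : ∀ c i (v : Vec ℕ n) → c ≢ i → NonZeroAt i v → NonZeroAt i (decAt c v)
nonZeroAt-decAt c i v c≢i nz = nz ∘′ trans (sym (entry-decAt-≢ c i v (c≢i ∘′ sym)))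

zerosBelow-incAt : ∀ c z (v : Vec ℕ n) → z ≤ c → ZerosBelow z v → ZerosBelow z (incAt c v)
zerosBelow-incAt c z v z≤c zb i i<z =
  trans (entry-incAt-≢ c i v (<⇒≢ (<-≤-trans i<z z≤c))) (zb i i<z)

zerosBelow-decAt : ∀ c z (v : Vec ℕ n) → ZerosBelow z v → ZerosBelow z (decAt c v)
zerosBelow-decAt c z v zb i i<z = entry-decAt-0 c i v (zb i i<z)

zerosBelow-mono : ∀ {c z} (v : Vec ℕ n) → c ≤ z → ZerosBelow z v → ZerosBelow c v
zerosBelow-mono v c≤z zb i i<c = zb i (<-≤-trans i<c c≤z)

zerosAbove-incAt : ∀ c j (v : Vec ℕ n) → c ≤ j → ZerosAbove j v → ZerosAbove j (incAt c v)
zerosAbove-incAt c j v c≤j za i j<i =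
  trans (entry-incAt-≢ c i v (≢-sym (<⇒≢ (≤-<-trans c≤j j<i)))) (za i j<i)

zerosAbove-decAt : ∀ c j (v : Vec ℕ n) → ZerosAbove j v → ZerosAbove j (decAt c v)
zerosAbove-decAt c j v za i j<i = entry-decAt-0 c i v (za i j<i)

zerosAbove-mono : ∀ {j x} (v : Vec ℕ n) → j ≤ x → ZerosAbove j v → ZerosAbove x v
zerosAbove-mono v j≤x za i x<i = za i (≤-<-trans j≤x x<i)

zerosAbove-last : ∀ {m} (v : Vec ℕ (suc m)) → ZerosAbove m v
zerosAbove-last {m} v i m<i with entry i v ≟ 0
... | yes eq = eq
... | no nz  = ⊥-elim (<-irrefl refl (<-≤-trans m<i (≤-pred (nonZeroAt⇒< i v nz))))

nonZeroAt⇒≤ : ∀ {i j} (v : Vec ℕ n) → NonZeroAt i v → ZerosAbove j v → i ≤ j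
nonZeroAt⇒≤ {i = i} {j} v nz za with i ≤? j
... | yes i≤j = i≤j
... | no  i≰j = ⊥-elim (nz (za i (≰⇒> i≰j)))

incAt-comm : ∀ a b (v : Vec ℕ n) → incAt a (incAt b v) ≡ incAt b (incAt a v)
incAt-comm a       b       []      = refl
incAt-comm zero    zero    (x ∷ v) = refl
incAt-comm zero    (suc b) (x ∷ v) = refl
incAt-comm (suc a) zero    (x ∷ v) = refl
incAt-comm (suc a) (suc b) (x ∷ v) = cong (x ∷_) (incAt-comm a b v)

decAt-incAt : ∀ a (v : Vec ℕ n) → decAt a (incAt a v) ≡ v
decAt-incAt a       []      = refl
decAt-incAt zero    (x ∷ v) = refl
decAt-incAt (suc a) (x ∷ v) = cong (x ∷_) (decAt-incAt a v)

incAt-decAt : ∀ a (v : Vec ℕ n) → NonZeroAt a v → incAt a (decAt a v) ≡ v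
incAt-decAt a       []          nz = ⊥-elim (nz refl)
incAt-decAt zero    (zero ∷ v)  nz = ⊥-elim (nz refl)
incAt-decAt zero    (suc x ∷ v) nz = refl
incAt-decAt (suc a) (x ∷ v)     nz = cong (x ∷_) (incAt-decAt a v nz)

decAt-incAt-incAt : ∀ a b (v : Vec ℕ n) → decAt a (incAt b (incAt a v)) ≡ incAt b v
decAt-incAt-incAt a b v = trans (cong (decAt a) (incAt-comm b a v)) (decAt-incAt a (incAt b v))

lastNZ-allZero : (v : Vec ℕ n) → AllZero v → lastNZ v ≡ nothing
lastNZ-allZero []      _  = refl
lastNZ-allZero (a ∷ v) az with lastNZ v | lastNZ-allZero v (λ i → az (suc i))
lastNZ-allZero (zero  ∷ v) az | _ | refl = refl
lastNZ-allZero (suc a ∷ v) az | _ | refl with az 0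
... | ()

lastNZ-isLast : ∀ j (v : Vec ℕ n) → IsLastNonZero j v → lastNZ v ≡ just j
lastNZ-isLast j       []      (nz , _)  = ⊥-elim (nz refl)
lastNZ-isLast zero    (a ∷ v) (nz , za) with lastNZ v | lastNZ-allZero v (λ i → za (suc i) (s≤s z≤n))
lastNZ-isLast zero    (zero  ∷ v) (nz , za) | _ | refl = ⊥-elim (nz refl)
lastNZ-isLast zero    (suc a ∷ v) (nz , za) | _ | refl = refl
lastNZ-isLast (suc j) (a ∷ v) (nz , za) with lastNZ v | lastNZ-isLast j v (nz , λ i j<i → za (suc i) (s≤s j<i))
... | _ | refl = refl

firstNZ-allZero : (v : Vec ℕ n) → AllZero v → firstNZ v ≡ nothing
firstNZ-allZero []          _  = refl
firstNZ-allZero (zero ∷ v)  az with firstNZ v | firstNZ-allZero v (λ i → az (suc i))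
... | _ | refl = refl
firstNZ-allZero (suc a ∷ v) az with az 0
... | ()

firstNZ-isFirst : ∀ z (v : Vec ℕ n) → IsFirstNonZero z v → firstNZ v ≡ just z
firstNZ-isFirst z       []          (nz , _)  = ⊥-elim (nz refl)
firstNZ-isFirst zero    (zero ∷ v)  (nz , _)  = ⊥-elim (nz refl)
firstNZ-isFirst zero    (suc a ∷ v) _         = refl
firstNZ-isFirst (suc z) (zero ∷ v)  (nz , zb) with firstNZ v | firstNZ-isFirst z v (nz , λ i i<z → zb (suc i) (s≤s i<z))
... | _ | refl = refl
firstNZ-isFirst (suc z) (suc a ∷ v) (_ , zb)  with zb 0 (s≤s z≤n)
... | ()

data LastView (v : Vec ℕ n) : Set where
  allZero : AllZero v → LastView v
  lastAt  : ∀ j → IsLastNonZero j v → LastView v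

lastView : (v : Vec ℕ n) → LastView v
lastView [] = allZero (λ _ → refl)
lastView (a ∷ v) with lastView v
... | lastAt j (nz , za) = lastAt (suc j) (nz , λ { zero () ; (suc i) (s≤s j<i) → za i j<i })
lastView (zero  ∷ v) | allZero az = allZero (λ { zero → refl ; (suc i) → az i })
lastView (suc a ∷ v) | allZero az = lastAt zero ((λ ()) , λ { zero () ; (suc i) _ → az i })

data FirstView (v : Vec ℕ n) : Set where
  allZero : AllZero v → FirstView v
  firstAt : ∀ z → IsFirstNonZero z v → FirstView v

firstView : (v : Vec ℕ n) → FirstView v
firstView []          = allZero (λ _ → refl)
firstView (suc a ∷ v) = firstAt zero ((λ ()) , λ _ ())
firstView (zero  ∷ v) with firstView v
... | allZero az        = allZero (λ { zero → refl ; (suc i) → az i })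
... | firstAt z (nz , zb) = firstAt (suc z) (nz , λ { zero _ → refl ; (suc i) (s≤s i<z) → zb i i<z })

isFirst-incAt : ∀ c z (v : Vec ℕ n) → z ≤ c → IsFirstNonZero z v → IsFirstNonZero z (incAt c v)
isFirst-incAt c z v z≤c (nz , zb) = nonZeroAt-incAt c z v nz , zerosBelow-incAt c z v z≤c zb

isFirst-incAt-self : ∀ c (v : Vec ℕ n) → c < n → ZerosBelow c v → IsFirstNonZero c (incAt c v)
isFirst-incAt-self c v c<n zb = nonZeroAt-incAt-self c v c<n , zerosBelow-incAt c c v ≤-refl zb

isLast-incAt : ∀ c j (v : Vec ℕ n) → c ≤ j → IsLastNonZero j v → IsLastNonZero j (incAt c v)
isLast-incAt c j v c≤j (nz , za) = nonZeroAt-incAt c j v nz , zerosAbove-incAt c j v c≤j za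

isLast-incAt-self : ∀ c (v : Vec ℕ n) → c < n → ZerosAbove c v → IsLastNonZero c (incAt c v)
isLast-incAt-self c v c<n za = nonZeroAt-incAt-self c v c<n , zerosAbove-incAt c c v ≤-refl za

move : ℕ → ℕ → Vec ℕ n → Vec ℕ n
move a b v = incAt b (decAt a v)

nonZeroAt⇒incAt : ∀ a (v : Vec ℕ n) → NonZeroAt a v → ∃ λ u → v ≡ incAt a u
nonZeroAt⇒incAt a v nz = decAt a v , sym (incAt-decAt a v nz)

nonZeroAt₂⇒incAt : ∀ a b (v : Vec ℕ n) → a ≢ b → NonZeroAt a v → NonZeroAt b v →
                   ∃ λ u → v ≡ incAt b (incAt a u)
nonZeroAt₂⇒incAt a b v a≢b nza nzb with nonZeroAt⇒incAt b v nzb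
... | w , refl with nonZeroAt⇒incAt a w (λ eq → nza (trans (entry-incAt-≢ b a w a≢b) eq))
...   | u , refl = u , refl

move-move : ∀ a b c (v : Vec ℕ n) → move b c (move a b v) ≡ move a c v
move-move a b c v = cong (incAt c) (decAt-incAt b (decAt a v))

move-inverse : ∀ a b (v : Vec ℕ n) → NonZeroAt a v → move b a (move a b v) ≡ v
move-inverse a b v nz = trans (move-move a b a v) (incAt-decAt a v nz)

incAt-move : ∀ a b c (v : Vec ℕ n) → NonZeroAt a v → incAt c (move a b v) ≡ move a b (incAt c v)
incAt-move a b c v nz with nonZeroAt⇒incAt a v nz
... | u , refl = begin
  incAt c (incAt b (decAt a (incAt a u)))  ≡⟨ cong (incAt c ∘′ incAt b) (decAt-incAt a u) ⟩
  incAt c (incAt b u)                      ≡⟨ incAt-comm c b u ⟩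
  incAt b (incAt c u)                      ≡⟨ cong (incAt b) (decAt-incAt-incAt a c u) ⟨
  incAt b (decAt a (incAt c (incAt a u)))  ∎

move-refill : ∀ a b c (v : Vec ℕ n) → a ≢ b → NonZeroAt a v → NonZeroAt b v →
              move a b (move b c v) ≡ move a c v
move-refill a b c v a≢b nza nzb with nonZeroAt₂⇒incAt a b v a≢b nza nzb
... | u , refl = begin
  incAt b (decAt a (incAt c (decAt b (incAt b (incAt a u)))))  ≡⟨ cong (incAt b ∘′ decAt a ∘′ incAt c) (decAt-incAt b (incAt a u)) ⟩
  incAt b (decAt a (incAt c (incAt a u)))                      ≡⟨ cong (incAt b) (decAt-incAt-incAt a c u) ⟩
  incAt b (incAt c u)                                          ≡⟨ incAt-comm b c u ⟩
  incAt c (incAt b u)                                          ≡⟨ cong (incAt c) (decAt-incAt-incAt a b u) ⟨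
  incAt c (decAt a (incAt b (incAt a u)))                      ∎

move-comm : ∀ a b c d (v : Vec ℕ n) → a ≢ b → NonZeroAt a v → NonZeroAt b v →
            move a c (move b d v) ≡ move b d (move a c v)
move-comm a b c d v a≢b nza nzb with nonZeroAt₂⇒incAt a b v a≢b nza nzb
... | u , refl = begin
  incAt c (decAt a (incAt d (decAt b (incAt b (incAt a u)))))  ≡⟨ cong (incAt c ∘′ decAt a ∘′ incAt d) (decAt-incAt b (incAt a u)) ⟩
  incAt c (decAt a (incAt d (incAt a u)))                      ≡⟨ cong (incAt c) (decAt-incAt-incAt a d u) ⟩
  incAt c (incAt d u)                                          ≡⟨ incAt-comm c d u ⟩
  incAt d (incAt c u)                                          ≡⟨ cong (incAt d) (decAt-incAt-incAt b c u) ⟨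
  incAt d (decAt b (incAt c (incAt b u)))                      ≡⟨ cong (incAt d ∘′ decAt b ∘′ incAt c) (decAt-incAt-incAt a b u) ⟨
  incAt d (decAt b (incAt c (decAt a (incAt b (incAt a u)))))  ∎

nonZeroAt-move : ∀ a b i (v : Vec ℕ n) → a ≢ i → NonZeroAt i v → NonZeroAt i (move a b v)
nonZeroAt-move a b i v a≢i nz = nonZeroAt-incAt b i (decAt a v) (nonZeroAt-decAt a i v a≢i nz)

zerosBelow-move : ∀ a b c (v : Vec ℕ n) → c ≤ b → ZerosBelow c v → ZerosBelow c (move a b v)
zerosBelow-move a b c v c≤b zb = zerosBelow-incAt b c (decAt a v) c≤b (zerosBelow-decAt a c v zb)

zerosAbove-move : ∀ a b j (v : Vec ℕ n) → b ≤ j → ZerosAbove j v → ZerosAbove j (move a b v)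
zerosAbove-move a b j v b≤j za = zerosAbove-incAt b j (decAt a v) b≤j (zerosAbove-decAt a j v za)

isFirst-move : ∀ a b z (v : Vec ℕ n) → z ≤ b → a ≢ z → IsFirstNonZero z v → IsFirstNonZero z (move a b v)
isFirst-move a b z v z≤b a≢z (nz , zb) = nonZeroAt-move a b z v a≢z nz , zerosBelow-move a b z v z≤b zb

isFirst-move-self : ∀ a b (v : Vec ℕ n) → b < n → ZerosBelow b v → IsFirstNonZero b (move a b v)
isFirst-move-self a b v b<n zb = isFirst-incAt-self b (decAt a v) b<n (zerosBelow-decAt a b v zb)

isLast-move : ∀ a b j (v : Vec ℕ n) → b ≤ j → a ≢ j → IsLastNonZero j v → IsLastNonZero j (move a b v)
isLast-move a b j v b≤j a≢j (nz , za) = nonZeroAt-move a b j v a≢j nz , zerosAbove-move a b j v b≤j za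

isLast-move-self : ∀ a b (v : Vec ℕ n) → b < n → ZerosAbove b v → IsLastNonZero b (move a b v)
isLast-move-self a b v b<n za = isLast-incAt-self b (decAt a v) b<n (zerosAbove-decAt a b v za)

nonZeroAt-move-self : ∀ a b (v : Vec ℕ n) → b < n → NonZeroAt b (move a b v)
nonZeroAt-move-self a b v = nonZeroAt-incAt-self b (decAt a v)

move-incAt : ∀ a b (v : Vec ℕ n) → move a b (incAt a v) ≡ incAt b v
move-incAt a b v = cong (incAt b) (decAt-incAt a v)

-- One row of right insertion and of the sweep of left insertion

-- The last row after right insertion, and the column then inserted into the earlier rows
-- (nothing: the insertion stops).
crLastRow : (m : ℕ) → Vec ℕ (suc m) → ℕ → Vec ℕ (suc m) × Maybe ℕ
crLastRow m R x with x ≟ m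
... | yes _ = incAt m R , nothing
... | no  _ with fromMaybe x (lastNZ R)
...   | y₁ with y₁ <? suc x
...     | yes _ = R , just x
...     | no  _ with y₁ <? m
...       | yes _ = move y₁ x R , just y₁
...       | no  _ = move m x R , nothing

crLastRow-diag : ∀ m R → crLastRow m R m ≡ (incAt m R , nothing)
crLastRow-diag m R with m ≟ m
... | yes _  = refl
... | no m≢m = ⊥-elim (m≢m refl)

crLastRow-keep : ∀ m R x → x < m → ZerosAbove x R → crLastRow m R x ≡ (R , just x)
crLastRow-keep m R x x<m za with x ≟ m
... | yes x≡m = ⊥-elim (<-irrefl x≡m x<m)
... | no  _ with lastView R
...   | allZero az rewrite lastNZ-allZero R az with x <? suc x
...     | yes _  = refl
...     | no x≮x = ⊥-elim (x≮x ≤-refl)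
crLastRow-keep m R x x<m za | no _ | lastAt j last rewrite lastNZ-isLast j R last with j <? suc x
...     | yes _  = refl
...     | no j≰x = ⊥-elim (j≰x (s≤s (nonZeroAt⇒≤ R (proj₁ last) za)))

crLastRow-bump : ∀ m R x j → x ≤ j → j < m → IsLastNonZero j R →
                 crLastRow m R x ≡ (move j x R , just j)
crLastRow-bump m R x j x≤j j<m last with x ≟ m
... | yes x≡m = ⊥-elim (<-irrefl x≡m (≤-<-trans x≤j j<m))
... | no  _ rewrite lastNZ-isLast j R last with j <? suc x
...   | yes j≤x rewrite ≤-antisym x≤j (≤-pred j≤x) = cong (_, just j) (sym (incAt-decAt j R (proj₁ last)))
...   | no  _ with j <? m
...     | yes _  = refl
...     | no j≮m = ⊥-elim (j≮m j<m)

crLastRow-exit : ∀ m R x → x < m → NonZeroAt m R → crLastRow m R x ≡ (move m x R , nothing)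
crLastRow-exit m R x x<m nz with x ≟ m
... | yes x≡m = ⊥-elim (<-irrefl x≡m x<m)
... | no  _ rewrite lastNZ-isLast m R (nz , zerosAbove-last R) with m <? suc x
...   | yes m≤x = ⊥-elim (<-irrefl refl (<-≤-trans x<m (≤-pred m≤x)))
...   | no  _ with m <? m
...     | yes m<m = ⊥-elim (<-irrefl refl m<m)
...     | no  _   = refl

data CrLastRowCase (m : ℕ) (R : Vec ℕ (suc m)) (x : ℕ) : Set where
  diag : x ≡ m → CrLastRowCase m R x
  keep : x < m → ZerosAbove x R → CrLastRowCase m R x
  bump : ∀ j → x < j → j < m → IsLastNonZero j R → CrLastRowCase m R x
  exit : x < m → NonZeroAt m R → CrLastRowCase m R x

crLastRowCase : ∀ m R x → x ≤ m → CrLastRowCase m R x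
crLastRowCase m R x x≤m with x <? m
... | no  x≮m = diag (≤-antisym x≤m (≮⇒≥ x≮m))
... | yes x<m with lastView R
...   | allZero az = keep x<m (λ i _ → az i)
...   | lastAt j (nz , za) with j ≤? x
...     | yes j≤x = keep x<m (zerosAbove-mono R j≤x za)
...     | no  j≰x with j <? m
...       | yes j<m = bump j (≰⇒> j≰x) j<m (nz , za)
...       | no  j≮m = exit x<m (subst (λ i → NonZeroAt i R) (≤-antisym (≤-pred (nonZeroAt⇒< j R nz)) (≮⇒≥ j≮m)) nz)

crLastRow-bound : ∀ m R x → x ≤ m → All (_< m) (proj₂ (crLastRow m R x))
crLastRow-bound m R x x≤m with crLastRowCase m R x x≤m
... | diag refl         rewrite crLastRow-diag m R = nothing
... | keep x<m za       rewrite crLastRow-keep m R x x<m za = just x<m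
... | bump j x<j j<m last rewrite crLastRow-bump m R x j (<⇒≤ x<j) j<m last = just j<m
... | exit x<m nz       rewrite crLastRow-exit m R x x<m nz = nothing

rowStep-allZero : ∀ m R s → AllZero R → rowStep m R s ≡ (R , s)
rowStep-allZero m R s az rewrite firstNZ-allZero R az = refl

rowStep-diag : ∀ m R → IsFirstNonZero m R → rowStep m R nothing ≡ (decAt m R , just m)
rowStep-diag m R first rewrite firstNZ-isFirst m R first with m ≟ m
... | yes _  = refl
... | no m≢m = ⊥-elim (m≢m refl)

rowStep-start : ∀ m R z → z < m → IsFirstNonZero z R → rowStep m R nothing ≡ (move z m R , just z)
rowStep-start m R z z<m first rewrite firstNZ-isFirst z R first with z ≟ m
... | yes z≡m = ⊥-elim (<-irrefl z≡m z<m)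
... | no  _   = refl

rowStep-shift : ∀ m R z c → z ≤ c → IsFirstNonZero z R → rowStep m R (just c) ≡ (move z c R , just z)
rowStep-shift m R z c z≤c first rewrite firstNZ-isFirst z R first with z <? c
... | yes _  = refl
... | no z≮c rewrite ≤-antisym z≤c (≮⇒≥ z≮c) = cong (_, just c) (sym (incAt-decAt c R (proj₁ first)))

rowStep-skip : ∀ m R c → ZerosBelow c R → rowStep m R (just c) ≡ (R , just c)
rowStep-skip m R c zb with firstView R
... | allZero az rewrite firstNZ-allZero R az = refl
... | firstAt z first rewrite firstNZ-isFirst z R first with z <? c
...   | yes z<c = ⊥-elim (proj₁ first (zb z z<c))
...   | no  _   = refl

data RowStepCase (m : ℕ) (R : Vec ℕ (suc m)) : Maybe ℕ → Set where
  allZero : ∀ {s} → AllZero R → RowStepCase m R s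
  diag    : IsFirstNonZero m R → RowStepCase m R nothing
  start   : ∀ z → z < m → IsFirstNonZero z R → RowStepCase m R nothing
  shift   : ∀ z {c} → z ≤ c → IsFirstNonZero z R → RowStepCase m R (just c)
  skip    : ∀ z {c} → c < z → IsFirstNonZero z R → RowStepCase m R (just c)

rowStepCase : ∀ m R s → RowStepCase m R s
rowStepCase m R s with firstView R
... | allZero az = allZero az
rowStepCase m R nothing  | firstAt z first with z <? m
... | yes z<m = start z z<m first
... | no  z≮m = diag (subst (λ i → IsFirstNonZero i R) z≡m first)
  where z≡m = ≤-antisym (≤-pred (nonZeroAt⇒< z R (proj₁ first))) (≮⇒≥ z≮m)
rowStepCase m R (just c) | firstAt z first with z ≤? c
... | yes z≤c = shift z z≤c first
... | no  z≰c = skip z (≰⇒> z≰c) first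

rowStep-bound : ∀ m R s → All (_< m) s → All (_< suc m) (proj₂ (rowStep m R s))
rowStep-bound m R s s<m with s<m | rowStepCase m R s
... | _            | allZero az        rewrite rowStep-allZero m R s az       = All.map m<n⇒m<1+n s<m
... | nothing      | diag first        rewrite rowStep-diag m R first         = just ≤-refl
... | nothing      | start z z<m first rewrite rowStep-start m R z z<m first  = just (m<n⇒m<1+n z<m)
... | just {c} c<m | shift z z≤c first rewrite rowStep-shift m R z c z≤c first = just (m<n⇒m<1+n (≤-<-trans z≤c c<m))
... | just {c} c<m | skip z c<z first
  rewrite rowStep-skip m R c (zerosBelow-mono R (<⇒≤ c<z) (proj₂ first)) = just (m<n⇒m<1+n c<m)

-- Right insertion commutes with the sweep, row by row

-- Here nothing stands for +∞: as a sweep state it is the paper's λ, as a column passed on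
-- by right insertion it means that nothing is inserted.
_⊓∞_ : Maybe ℕ → Maybe ℕ → Maybe ℕ
nothing ⊓∞ b       = b
just a  ⊓∞ nothing = just a
just a  ⊓∞ just b  = just (a ⊓ b)

_⊔∞_ : Maybe ℕ → Maybe ℕ → Maybe ℕ
nothing ⊔∞ _       = nothing
just a  ⊔∞ nothing = nothing
just a  ⊔∞ just b  = just (a ⊔ b)

⊓∞-identityʳ : ∀ a → a ⊓∞ nothing ≡ a
⊓∞-identityʳ nothing  = refl
⊓∞-identityʳ (just _) = refl

⊔∞-zeroʳ : ∀ a → a ⊔∞ nothing ≡ nothing
⊔∞-zeroʳ nothing  = refl
⊔∞-zeroʳ (just _) = refl

crLastRow? : (m : ℕ) → Vec ℕ (suc m) → Maybe ℕ → Vec ℕ (suc m) × Maybe ℕ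
crLastRow? m R = maybe (crLastRow m R) (R , nothing)

-- The passed-on column, the new last row and the outgoing sweep state on the two sides of
-- sweep-Cr'? below.
sweepRowAfterCr : (m : ℕ) → Vec ℕ (suc m) → ℕ → Maybe ℕ → Maybe ℕ × Vec ℕ (suc m) × Maybe ℕ
sweepRowAfterCr m R x s =
  let (R₁ , k)  = crLastRow m R x
      (R₂ , s₂) = rowStep m R₁ (s ⊓∞ k)
  in s ⊔∞ k , R₂ , s₂

crRowAfterSweep : (m : ℕ) → Vec ℕ (suc m) → ℕ → Maybe ℕ → Maybe ℕ × Vec ℕ (suc m) × Maybe ℕ
crRowAfterSweep m R x s =
  let (R₃ , s₃) = rowStep m R s
      (R₄ , k)  = crLastRow? m R₃ (s₃ ⊔∞ just x)
  in k , R₄ , s₃ ⊓∞ just x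

sweepRow-crLastRow-diag : ∀ m R s → All (_< m) s → sweepRowAfterCr m R m s ≡ crRowAfterSweep m R m s
sweepRow-crLastRow-diag m R s s<m rewrite crLastRow-diag m R | ⊔∞-zeroʳ s | ⊓∞-identityʳ s with s<m | rowStepCase m R s
... | nothing | allZero az
  rewrite rowStep-allZero m R nothing az
        | rowStep-diag m (incAt m R) (isFirst-incAt-self m R ≤-refl (λ i _ → az i))
        | decAt-incAt m R = refl
... | just {c} c<m | allZero az
  rewrite rowStep-allZero m R (just c) az
        | m≤n⇒m⊔n≡n (<⇒≤ c<m) | m≤n⇒m⊓n≡m (<⇒≤ c<m)
        | rowStep-skip m (incAt m R) c (zerosBelow-incAt m c R (<⇒≤ c<m) (λ i _ → az i))
        | crLastRow-diag m R = refl
... | nothing | diag first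
  rewrite rowStep-diag m R first
        | ⊔-idem m | ⊓-idem m
        | rowStep-diag m (incAt m R) (isFirst-incAt m m R ≤-refl first)
        | crLastRow-diag m (decAt m R)
        | decAt-incAt m R | incAt-decAt m R (proj₁ first) = refl
... | nothing | start z z<m first
  rewrite rowStep-start m R z z<m first
        | m≤n⇒m⊔n≡n (<⇒≤ z<m) | m≤n⇒m⊓n≡m (<⇒≤ z<m)
        | rowStep-start m (incAt m R) z z<m (isFirst-incAt m z R (<⇒≤ z<m) first)
        | crLastRow-diag m (move z m R)
        | incAt-move z m m R (proj₁ first) = refl
... | just {c} c<m | shift z z≤c first
  rewrite rowStep-shift m R z c z≤c first
        | m≤n⇒m⊔n≡n (<⇒≤ (≤-<-trans z≤c c<m)) | m≤n⇒m⊓n≡m (<⇒≤ (≤-<-trans z≤c c<m))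
        | rowStep-shift m (incAt m R) z c z≤c (isFirst-incAt m z R (<⇒≤ (≤-<-trans z≤c c<m)) first)
        | crLastRow-diag m (move z c R)
        | incAt-move z c m R (proj₁ first) = refl
... | just {c} c<m | skip z c<z first
  rewrite rowStep-skip m R c (zerosBelow-mono R (<⇒≤ c<z) (proj₂ first))
        | m≤n⇒m⊔n≡n (<⇒≤ c<m) | m≤n⇒m⊓n≡m (<⇒≤ c<m)
        | rowStep-skip m (incAt m R) c (zerosBelow-incAt m c R (<⇒≤ c<m) (zerosBelow-mono R (<⇒≤ c<z) (proj₂ first)))
        | crLastRow-diag m R = refl

sweepRow-crLastRow-keep : ∀ m R x s → x < m → ZerosAbove x R → All (_< m) s →
            sweepRowAfterCr m R x s ≡ crRowAfterSweep m R x s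
sweepRow-crLastRow-keep m R x s x<m za s<m rewrite crLastRow-keep m R x x<m za with s<m | rowStepCase m R s
... | nothing | allZero az
  rewrite rowStep-allZero m R nothing az | rowStep-allZero m R (just x) az = refl
... | just {c} c<m | allZero az
  rewrite rowStep-allZero m R (just c) az | rowStep-allZero m R (just (c ⊓ x)) az
        | crLastRow-keep m R (c ⊔ x) (⊔-pres-<m c<m x<m) (λ i _ → az i) = refl
... | nothing | diag (nz , _) = ⊥-elim (nz (za m x<m))
... | nothing | start z z<m first
  rewrite rowStep-start m R z z<m first
        | m≤n⇒m⊔n≡n (nonZeroAt⇒≤ R (proj₁ first) za) | m≤n⇒m⊓n≡m (nonZeroAt⇒≤ R (proj₁ first) za)
        | rowStep-shift m R z x (nonZeroAt⇒≤ R (proj₁ first) za) first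
        | crLastRow-exit m (move z m R) x x<m (nonZeroAt-incAt-self m (decAt z R) ≤-refl)
        | move-move z m x R = refl
... | just {c} c<m | skip z c<z first
  rewrite rowStep-skip m R c (zerosBelow-mono R (<⇒≤ c<z) (proj₂ first))
        | m≤n⇒m⊔n≡n (<⇒≤ (<-≤-trans c<z (nonZeroAt⇒≤ R (proj₁ first) za)))
        | m≤n⇒m⊓n≡m (<⇒≤ (<-≤-trans c<z (nonZeroAt⇒≤ R (proj₁ first) za)))
        | rowStep-skip m R c (zerosBelow-mono R (<⇒≤ c<z) (proj₂ first))
        | crLastRow-keep m R x x<m za = refl
... | just {c} c<m | shift z z≤c first with x <? c
...   | yes x<c
  rewrite rowStep-shift m R z c z≤c first
        | m≥n⇒m⊔n≡m (<⇒≤ x<c) | m≥n⇒m⊓n≡n (<⇒≤ x<c)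
        | m≤n⇒m⊔n≡n (nonZeroAt⇒≤ R (proj₁ first) za) | m≤n⇒m⊓n≡m (nonZeroAt⇒≤ R (proj₁ first) za)
        | rowStep-shift m R z x (nonZeroAt⇒≤ R (proj₁ first) za) first
        | crLastRow-bump m (move z c R) x c (<⇒≤ x<c) c<m
            (isLast-move-self z c R (m<n⇒m<1+n c<m) (zerosAbove-mono R (<⇒≤ x<c) za))
        | move-move z c x R = refl
...   | no x≮c
  rewrite rowStep-shift m R z c z≤c first
        | m≤n⇒m⊔n≡n (≮⇒≥ x≮c) | m≤n⇒m⊓n≡m (≮⇒≥ x≮c)
        | m≤n⇒m⊔n≡n (nonZeroAt⇒≤ R (proj₁ first) za) | m≤n⇒m⊓n≡m (nonZeroAt⇒≤ R (proj₁ first) za)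
        | rowStep-shift m R z c z≤c first
        | crLastRow-keep m (move z c R) x x<m (zerosAbove-move z c x R (≮⇒≥ x≮c) za) = refl

module _ {m : ℕ} {R : Vec ℕ (suc m)} {x j : ℕ} (x<j : x < j) (j<m : j < m) (last : IsLastNonZero j R) where

  sweepRow-crLastRow-bump-start : ∀ z → z < m → IsFirstNonZero z R →
                                  sweepRowAfterCr m R x nothing ≡ crRowAfterSweep m R x nothing
  sweepRow-crLastRow-bump-start z z<m first
    rewrite crLastRow-bump m R x j (<⇒≤ x<j) j<m last | rowStep-start m R z z<m first with z ≤? x
  ... | yes z≤x
    rewrite m≤n⇒m⊔n≡n z≤x | m≤n⇒m⊓n≡m z≤x
          | rowStep-shift m (move j x R) z j (nonZeroAt⇒≤ R (proj₁ first) (proj₂ last))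
              (isFirst-move j x z R z≤x (≢-sym (<⇒≢ (≤-<-trans z≤x x<j))) first)
          | crLastRow-exit m (move z m R) x (<-trans x<j j<m) (nonZeroAt-move-self z m R ≤-refl)
          | move-move z m x R
          | move-refill z j x R (<⇒≢ (≤-<-trans z≤x x<j)) (proj₁ first) (proj₁ last) = refl
  ... | no z≰x
    rewrite m≥n⇒m⊔n≡m (<⇒≤ (≰⇒> z≰x)) | m≥n⇒m⊓n≡n (<⇒≤ (≰⇒> z≰x))
          | rowStep-shift m (move j x R) x j (<⇒≤ x<j)
              (isFirst-move-self j x R (m<n⇒m<1+n (<-trans x<j j<m)) (zerosBelow-mono R (<⇒≤ (≰⇒> z≰x)) (proj₂ first)))
          | crLastRow-exit m (move z m R) z z<m (nonZeroAt-move-self z m R ≤-refl)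
          | move-inverse z m R (proj₁ first) | move-inverse j x R (proj₁ last) = refl

  sweepRow-crLastRow-bump-shift : ∀ z {c} → c < m → z ≤ c → IsFirstNonZero z R →
                                  sweepRowAfterCr m R x (just c) ≡ crRowAfterSweep m R x (just c)
  sweepRow-crLastRow-bump-shift z {c} c<m z≤c first
    rewrite crLastRow-bump m R x j (<⇒≤ x<j) j<m last | rowStep-shift m R z c z≤c first with z ≤? x | c <? j
  ... | yes z≤x | yes c<j
    rewrite m≤n⇒m⊔n≡n z≤x | m≤n⇒m⊓n≡m z≤x | m≤n⇒m⊔n≡n (<⇒≤ c<j) | m≤n⇒m⊓n≡m (<⇒≤ c<j)
          | rowStep-shift m (move j x R) z c z≤c (isFirst-move j x z R z≤x (≢-sym (<⇒≢ (≤-<-trans z≤x x<j))) first)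
          | crLastRow-bump m (move z c R) x j (<⇒≤ x<j) j<m
              (isLast-move z c j R (<⇒≤ c<j) (<⇒≢ (≤-<-trans z≤x x<j)) last)
          | move-comm z j c x R (<⇒≢ (≤-<-trans z≤x x<j)) (proj₁ first) (proj₁ last) = refl
  ... | yes z≤x | no c≮j
    rewrite m≤n⇒m⊔n≡n z≤x | m≤n⇒m⊓n≡m z≤x | m≥n⇒m⊔n≡m (≮⇒≥ c≮j) | m≥n⇒m⊓n≡n (≮⇒≥ c≮j)
          | rowStep-shift m (move j x R) z j (nonZeroAt⇒≤ R (proj₁ first) (proj₂ last))
              (isFirst-move j x z R z≤x (≢-sym (<⇒≢ (≤-<-trans z≤x x<j))) first)
          | crLastRow-bump m (move z c R) x c (<⇒≤ (<-≤-trans x<j (≮⇒≥ c≮j))) c<m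
              (isLast-move-self z c R (m<n⇒m<1+n c<m) (zerosAbove-mono R (≮⇒≥ c≮j) (proj₂ last)))
          | move-move z c x R
          | move-refill z j x R (<⇒≢ (≤-<-trans z≤x x<j)) (proj₁ first) (proj₁ last) = refl
  ... | no z≰x | yes c<j
    rewrite m≥n⇒m⊔n≡m (<⇒≤ (≰⇒> z≰x)) | m≥n⇒m⊓n≡n (<⇒≤ (≰⇒> z≰x))
          | m≤n⇒m⊔n≡n (<⇒≤ c<j) | m≤n⇒m⊓n≡m (<⇒≤ c<j)
          | rowStep-shift m (move j x R) x c (<⇒≤ (<-≤-trans (≰⇒> z≰x) z≤c))
              (isFirst-move-self j x R (m<n⇒m<1+n (<-trans x<j j<m)) (zerosBelow-mono R (<⇒≤ (≰⇒> z≰x)) (proj₂ first)))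
          | crLastRow-bump m (move z c R) z j (≤-trans z≤c (<⇒≤ c<j)) j<m
              (isLast-move z c j R (<⇒≤ c<j) (<⇒≢ (≤-<-trans z≤c c<j)) last)
          | move-move j x c R
          | move-refill j z c R (≢-sym (<⇒≢ (≤-<-trans z≤c c<j))) (proj₁ last) (proj₁ first) = refl
  ... | no z≰x | no c≮j
    rewrite m≥n⇒m⊔n≡m (<⇒≤ (≰⇒> z≰x)) | m≥n⇒m⊓n≡n (<⇒≤ (≰⇒> z≰x))
          | m≥n⇒m⊔n≡m (≮⇒≥ c≮j) | m≥n⇒m⊓n≡n (≮⇒≥ c≮j)
          | rowStep-shift m (move j x R) x j (<⇒≤ x<j)
              (isFirst-move-self j x R (m<n⇒m<1+n (<-trans x<j j<m)) (zerosBelow-mono R (<⇒≤ (≰⇒> z≰x)) (proj₂ first)))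
          | crLastRow-bump m (move z c R) z c z≤c c<m
              (isLast-move-self z c R (m<n⇒m<1+n c<m) (zerosAbove-mono R (≮⇒≥ c≮j) (proj₂ last)))
          | move-inverse z c R (proj₁ first) | move-inverse j x R (proj₁ last) = refl

  sweepRow-crLastRow-bump-skip : ∀ z {c} → c < z → IsFirstNonZero z R →
                                 sweepRowAfterCr m R x (just c) ≡ crRowAfterSweep m R x (just c)
  sweepRow-crLastRow-bump-skip z {c} c<z first
    rewrite crLastRow-bump m R x j (<⇒≤ x<j) j<m last
          | rowStep-skip m R c (zerosBelow-mono R (<⇒≤ c<z) (proj₂ first))
          | m≤n⇒m⊔n≡n (<⇒≤ (<-≤-trans c<z (nonZeroAt⇒≤ R (proj₁ first) (proj₂ last))))
          | m≤n⇒m⊓n≡m (<⇒≤ (<-≤-trans c<z (nonZeroAt⇒≤ R (proj₁ first) (proj₂ last)))) with c ≤? x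
  ... | yes c≤x
    rewrite m≤n⇒m⊔n≡n c≤x | m≤n⇒m⊓n≡m c≤x
          | rowStep-skip m (move j x R) c (zerosBelow-move j x c R c≤x (zerosBelow-mono R (<⇒≤ c<z) (proj₂ first)))
          | crLastRow-bump m R x j (<⇒≤ x<j) j<m last = refl
  ... | no c≰x
    rewrite m≥n⇒m⊔n≡m (<⇒≤ (≰⇒> c≰x)) | m≥n⇒m⊓n≡n (<⇒≤ (≰⇒> c≰x))
          | rowStep-shift m (move j x R) x c (<⇒≤ (≰⇒> c≰x))
              (isFirst-move-self j x R (m<n⇒m<1+n (<-trans x<j j<m))
                (zerosBelow-mono R (<⇒≤ (<-trans (≰⇒> c≰x) c<z)) (proj₂ first)))
          | crLastRow-bump m R c j (<⇒≤ (<-≤-trans c<z (nonZeroAt⇒≤ R (proj₁ first) (proj₂ last)))) j<m last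
          | move-move j x c R = refl

sweepRow-crLastRow-bump : ∀ m R x j s → x < j → j < m → IsLastNonZero j R → All (_< m) s →
                          sweepRowAfterCr m R x s ≡ crRowAfterSweep m R x s
sweepRow-crLastRow-bump m R x j s x<j j<m last s<m with s<m | rowStepCase m R s
... | _        | allZero az        = ⊥-elim (proj₁ last (az j))
... | nothing  | diag (nz , _)     = ⊥-elim (nz (proj₂ last m j<m))
... | nothing  | start z z<m first = sweepRow-crLastRow-bump-start x<j j<m last z z<m first
... | just c<m | shift z z≤c first = sweepRow-crLastRow-bump-shift x<j j<m last z c<m z≤c first
... | just _   | skip z c<z first  = sweepRow-crLastRow-bump-skip x<j j<m last z c<z first

module _ {m : ℕ} {R : Vec ℕ (suc m)} {x : ℕ} (x<m : x < m) (nzm : NonZeroAt m R) where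

  sweepRow-crLastRow-exit-nothing : sweepRowAfterCr m R x nothing ≡ crRowAfterSweep m R x nothing
  sweepRow-crLastRow-exit-nothing rewrite crLastRow-exit m R x x<m nzm with rowStepCase m R nothing
  ... | allZero az = ⊥-elim (nzm (az m))
  ... | diag first
    rewrite rowStep-diag m R first
          | m≥n⇒m⊔n≡m (<⇒≤ x<m) | m≥n⇒m⊓n≡n (<⇒≤ x<m)
          | rowStep-start m (move m x R) x x<m
              (isFirst-move-self m x R (m<n⇒m<1+n x<m) (zerosBelow-mono R (<⇒≤ x<m) (proj₂ first)))
          | crLastRow-diag m (decAt m R)
          | move-inverse m x R nzm | incAt-decAt m R nzm = refl
  ... | start z z<m first with z ≤? x
  ...   | yes z≤x
    rewrite rowStep-start m R z z<m first
          | m≤n⇒m⊔n≡n z≤x | m≤n⇒m⊓n≡m z≤x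
          | rowStep-start m (move m x R) z z<m (isFirst-move m x z R z≤x (≢-sym (<⇒≢ z<m)) first)
          | crLastRow-exit m (move z m R) x x<m (nonZeroAt-move-self z m R ≤-refl)
          | move-move z m x R
          | move-refill z m x R (<⇒≢ z<m) (proj₁ first) nzm = refl
  ...   | no z≰x
    rewrite rowStep-start m R z z<m first
          | m≥n⇒m⊔n≡m (<⇒≤ (≰⇒> z≰x)) | m≥n⇒m⊓n≡n (<⇒≤ (≰⇒> z≰x))
          | rowStep-start m (move m x R) x x<m
              (isFirst-move-self m x R (m<n⇒m<1+n x<m) (zerosBelow-mono R (<⇒≤ (≰⇒> z≰x)) (proj₂ first)))
          | crLastRow-exit m (move z m R) z z<m (nonZeroAt-move-self z m R ≤-refl)
          | move-inverse z m R (proj₁ first) | move-inverse m x R nzm = refl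

  sweepRow-crLastRow-exit-just : ∀ {c} → c < m → sweepRowAfterCr m R x (just c) ≡ crRowAfterSweep m R x (just c)
  sweepRow-crLastRow-exit-just {c} c<m rewrite crLastRow-exit m R x x<m nzm with rowStepCase m R (just c)
  ... | allZero az = ⊥-elim (nzm (az m))
  ... | shift z z≤c first with z ≤? x
  ...   | yes z≤x
    rewrite rowStep-shift m R z c z≤c first
          | m≤n⇒m⊔n≡n z≤x | m≤n⇒m⊓n≡m z≤x
          | rowStep-shift m (move m x R) z c z≤c (isFirst-move m x z R z≤x (≢-sym (<⇒≢ (≤-<-trans z≤c c<m))) first)
          | crLastRow-exit m (move z c R) x x<m (nonZeroAt-move z c m R (<⇒≢ (≤-<-trans z≤c c<m)) nzm)
          | move-comm z m c x R (<⇒≢ (≤-<-trans z≤c c<m)) (proj₁ first) nzm = refl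
  ...   | no z≰x
    rewrite rowStep-shift m R z c z≤c first
          | m≥n⇒m⊔n≡m (<⇒≤ (≰⇒> z≰x)) | m≥n⇒m⊓n≡n (<⇒≤ (≰⇒> z≰x))
          | rowStep-shift m (move m x R) x c (<⇒≤ (<-≤-trans (≰⇒> z≰x) z≤c))
              (isFirst-move-self m x R (m<n⇒m<1+n x<m) (zerosBelow-mono R (<⇒≤ (≰⇒> z≰x)) (proj₂ first)))
          | crLastRow-exit m (move z c R) z (≤-<-trans z≤c c<m) (nonZeroAt-move z c m R (<⇒≢ (≤-<-trans z≤c c<m)) nzm)
          | move-move m x c R
          | move-refill m z c R (≢-sym (<⇒≢ (≤-<-trans z≤c c<m))) nzm (proj₁ first) = refl
  sweepRow-crLastRow-exit-just {c} c<m | skip z c<z first with c ≤? x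
  ...   | yes c≤x
    rewrite rowStep-skip m R c (zerosBelow-mono R (<⇒≤ c<z) (proj₂ first))
          | m≤n⇒m⊔n≡n c≤x | m≤n⇒m⊓n≡m c≤x
          | rowStep-skip m (move m x R) c (zerosBelow-move m x c R c≤x (zerosBelow-mono R (<⇒≤ c<z) (proj₂ first)))
          | crLastRow-exit m R x x<m nzm = refl
  ...   | no c≰x
    rewrite rowStep-skip m R c (zerosBelow-mono R (<⇒≤ c<z) (proj₂ first))
          | m≥n⇒m⊔n≡m (<⇒≤ (≰⇒> c≰x)) | m≥n⇒m⊓n≡n (<⇒≤ (≰⇒> c≰x))
          | rowStep-shift m (move m x R) x c (<⇒≤ (≰⇒> c≰x))
              (isFirst-move-self m x R (m<n⇒m<1+n x<m) (zerosBelow-mono R (<⇒≤ (<-trans (≰⇒> c≰x) c<z)) (proj₂ first)))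
          | crLastRow-exit m R c c<m nzm
          | move-move m x c R = refl

sweepRow-crLastRow-exit : ∀ m R x s → x < m → NonZeroAt m R → All (_< m) s →
                          sweepRowAfterCr m R x s ≡ crRowAfterSweep m R x s
sweepRow-crLastRow-exit m R x _ x<m nzm nothing     = sweepRow-crLastRow-exit-nothing x<m nzm
sweepRow-crLastRow-exit m R x _ x<m nzm (just c<m)  = sweepRow-crLastRow-exit-just x<m nzm c<m

sweepRow-crLastRow-comm : ∀ m R x s → x ≤ m → All (_< m) s → sweepRowAfterCr m R x s ≡ crRowAfterSweep m R x s
sweepRow-crLastRow-comm m R x s x≤m s<m with crLastRowCase m R x x≤m
... | diag refl            = sweepRow-crLastRow-diag m R s s<m
... | keep x<m za          = sweepRow-crLastRow-keep m R x s x<m za s<m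
... | bump j x<j j<m last  = sweepRow-crLastRow-bump m R x j s x<j j<m last s<m
... | exit x<m nzm         = sweepRow-crLastRow-exit m R x s x<m nzm s<m

clLastRowAfterCr : (m : ℕ) → Vec ℕ (suc m) → ℕ → Maybe ℕ → Maybe ℕ × Vec ℕ (suc m)
clLastRowAfterCr m R x s =
  let (R₁ , k) = crLastRow m R x
  in s ⊔∞ k , incAt (fromMaybe m (s ⊓∞ k)) R₁

crAfterClLastRow : (m : ℕ) → Vec ℕ (suc m) → ℕ → Maybe ℕ → Maybe ℕ × Vec ℕ (suc m)
crAfterClLastRow m R x s =
  let (R₁ , k) = crLastRow m (incAt (fromMaybe m s) R) x
  in k , R₁

clLastRow-crLastRow-comm : ∀ m R x s → x ≤ m → All (_< m) s → clLastRowAfterCr m R x s ≡ crAfterClLastRow m R x s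
clLastRow-crLastRow-comm m R x s x≤m s<m with crLastRowCase m R x x≤m
... | diag refl
  rewrite crLastRow-diag m R | ⊔∞-zeroʳ s | ⊓∞-identityʳ s
        | crLastRow-diag m (incAt (fromMaybe m s) R) | incAt-comm (fromMaybe m s) m R = refl
... | exit x<m nzm
  rewrite crLastRow-exit m R x x<m nzm | ⊔∞-zeroʳ s | ⊓∞-identityʳ s
        | crLastRow-exit m (incAt (fromMaybe m s) R) x x<m (nonZeroAt-incAt (fromMaybe m s) m R nzm)
        | incAt-move m x (fromMaybe m s) R nzm = refl
... | keep x<m za with s<m
...   | nothing
  rewrite crLastRow-keep m R x x<m za
        | crLastRow-exit m (incAt m R) x x<m (nonZeroAt-incAt-self m R ≤-refl)
        | move-incAt m x R = refl
...   | just {c} c<m with x <? c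
...     | yes x<c
  rewrite crLastRow-keep m R x x<m za
        | m≥n⇒m⊔n≡m (<⇒≤ x<c) | m≥n⇒m⊓n≡n (<⇒≤ x<c)
        | crLastRow-bump m (incAt c R) x c (<⇒≤ x<c) c<m
            (isLast-incAt-self c R (m<n⇒m<1+n c<m) (zerosAbove-mono R (<⇒≤ x<c) za))
        | move-incAt c x R = refl
...     | no x≮c
  rewrite crLastRow-keep m R x x<m za
        | m≤n⇒m⊔n≡n (≮⇒≥ x≮c) | m≤n⇒m⊓n≡m (≮⇒≥ x≮c)
        | crLastRow-keep m (incAt c R) x x<m (zerosAbove-incAt c x R (≮⇒≥ x≮c) za) = refl
clLastRow-crLastRow-comm m R x s x≤m s<m | bump j x<j j<m last with s<m
...   | nothing
  rewrite crLastRow-bump m R x j (<⇒≤ x<j) j<m last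
        | crLastRow-exit m (incAt m R) x (<-trans x<j j<m) (nonZeroAt-incAt-self m R ≤-refl)
        | incAt-move j x j R (proj₁ last) | move-incAt m x R | move-incAt j x R = refl
...   | just {c} c<m with c <? j
...     | yes c<j
  rewrite crLastRow-bump m R x j (<⇒≤ x<j) j<m last
        | m≤n⇒m⊔n≡n (<⇒≤ c<j) | m≤n⇒m⊓n≡m (<⇒≤ c<j)
        | crLastRow-bump m (incAt c R) x j (<⇒≤ x<j) j<m (isLast-incAt c j R (<⇒≤ c<j) last)
        | incAt-move j x c R (proj₁ last) = refl
...     | no c≮j
  rewrite crLastRow-bump m R x j (<⇒≤ x<j) j<m last
        | m≥n⇒m⊔n≡m (≮⇒≥ c≮j) | m≥n⇒m⊓n≡n (≮⇒≥ c≮j)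
        | crLastRow-bump m (incAt c R) x c (<⇒≤ (<-≤-trans x<j (≮⇒≥ c≮j))) c<m
            (isLast-incAt-self c R (m<n⇒m<1+n c<m) (zerosAbove-mono R (≮⇒≥ c≮j) (proj₂ last)))
        | incAt-move j x j R (proj₁ last) | move-incAt c x R | move-incAt j x R = refl

-- Staircases

Cr'? : (m : ℕ) → Stair m → Maybe ℕ → Stair m
Cr'? m t = maybe (Cr' m t) t

Cr'-suc : ∀ m t R x → Cr' (suc m) (t , R) x ≡ (Cr'? m t (proj₂ (crLastRow m R x)) , proj₁ (crLastRow m R x))
Cr'-suc m t R x with x ≟ m
... | yes _ = refl
... | no  _ with fromMaybe x (lastNZ R)
...   | y₁ with y₁ <? suc x
...     | yes _ = refl
...     | no  _ with y₁ <? m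
...       | yes _ = refl
...       | no  _ = refl

Cr'?-suc : ∀ m t R k → Cr'? (suc m) (t , R) k ≡ (Cr'? m t (proj₂ (crLastRow? m R k)) , proj₁ (crLastRow? m R k))
Cr'?-suc m t R nothing  = refl
Cr'?-suc m t R (just x) = Cr'-suc m t R x

sweep-bound : ∀ m t → All (_< m) (proj₂ (sweep m t nothing))
sweep-bound zero    t       = nothing
sweep-bound (suc m) (t , R) = rowStep-bound m R _ (sweep-bound m t)

sweep-Cr'? : ∀ m t k → All (_< m) k →
             let (t₁ , s) = sweep m t nothing
             in sweep m (Cr'? m t k) nothing ≡ (Cr'? m t₁ (s ⊔∞ k) , s ⊓∞ k)
sweep-Cr'? m t nothing _
  rewrite ⊔∞-zeroʳ (proj₂ (sweep m t nothing)) | ⊓∞-identityʳ (proj₂ (sweep m t nothing)) = refl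
sweep-Cr'? (suc m) (t , R) (just x) (just x<m) = begin
  sweep (suc m) (Cr' (suc m) (t , R) x) nothing
    ≡⟨ cong (λ u → sweep (suc m) u nothing) (Cr'-suc m t R x) ⟩
  sweep (suc m) (Cr'? m t k , R₁) nothing
    ≡⟨ cong (λ (u , s′) → (u , proj₁ (rowStep m R₁ s′)) , proj₂ (rowStep m R₁ s′))
            (sweep-Cr'? m t k (crLastRow-bound m R x (≤-pred x<m))) ⟩
  (Cr'? m t₁ (s ⊔∞ k) , proj₁ (rowStep m R₁ (s ⊓∞ k))) , proj₂ (rowStep m R₁ (s ⊓∞ k))
    ≡⟨ cong (λ (k′ , R′ , s′) → (Cr'? m t₁ k′ , R′) , s′)
            (sweepRow-crLastRow-comm m R x s (≤-pred x<m) (sweep-bound m t)) ⟩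
  (Cr'? m t₁ (proj₂ (crLastRow? m R₃ w)) , proj₁ (crLastRow? m R₃ w)) , s₃ ⊓∞ just x
    ≡⟨ cong (_, s₃ ⊓∞ just x) (Cr'?-suc m t₁ R₃ w) ⟨
  Cr'? (suc m) (t₁ , R₃) w , s₃ ⊓∞ just x
    ∎
  where
  R₁ = proj₁ (crLastRow m R x)
  k  = proj₂ (crLastRow m R x)
  t₁ = proj₁ (sweep m t nothing)
  s  = proj₂ (sweep m t nothing)
  R₃ = proj₁ (rowStep m R s)
  s₃ = proj₂ (rowStep m R s)
  w  = s₃ ⊔∞ just x

Cl'-suc-≢ : ∀ m t R y → y ≢ m → Cl' (suc m) (t , R) y ≡ (Cl' m t y , R)
Cl'-suc-≢ m t R y y≢m with y ≟ m
... | yes y≡m = contradiction y≡m y≢m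
... | no  _   = refl

Cl'-suc-diag : ∀ m t R → Cl' (suc m) (t , R) m ≡ (proj₁ (sweep m t nothing) , incAt (fromMaybe m (proj₂ (sweep m t nothing))) R)
Cl'-suc-diag m t R with m ≟ m
... | no m≢m = contradiction refl m≢m
... | yes _ with sweep m t nothing
...   | t₁ , nothing = refl
...   | t₁ , just c  = refl

Cl'-Cr'-comm-below : ∀ m t R x y → x ≤ m → y ≢ m →
                     (∀ x′ → x′ < m → Cl' m (Cr' m t x′) y ≡ Cr' m (Cl' m t y) x′) →
                     Cl' (suc m) (Cr' (suc m) (t , R) x) y ≡ Cr' (suc m) (Cl' (suc m) (t , R) y) x
Cl'-Cr'-comm-below m t R x y x≤m y≢m ih = begin
  Cl' (suc m) (Cr' (suc m) (t , R) x) y   ≡⟨ cong (λ u → Cl' (suc m) u y) (Cr'-suc m t R x) ⟩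
  Cl' (suc m) (Cr'? m t k , R₁) y         ≡⟨ Cl'-suc-≢ m (Cr'? m t k) R₁ y y≢m ⟩
  Cl' m (Cr'? m t k) y , R₁               ≡⟨ cong (_, R₁) (ih? k (crLastRow-bound m R x x≤m)) ⟩
  Cr'? m (Cl' m t y) k , R₁               ≡⟨ Cr'-suc m (Cl' m t y) R x ⟨
  Cr' (suc m) (Cl' m t y , R) x           ≡⟨ cong (λ u → Cr' (suc m) u x) (Cl'-suc-≢ m t R y y≢m) ⟨
  Cr' (suc m) (Cl' (suc m) (t , R) y) x   ∎
  where
  R₁ = proj₁ (crLastRow m R x)
  k  = proj₂ (crLastRow m R x)
  ih? : ∀ k → All (_< m) k → Cl' m (Cr'? m t k) y ≡ Cr'? m (Cl' m t y) k
  ih? nothing   _           = refl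
  ih? (just x′) (just x′<m) = ih x′ x′<m

Cl'-Cr'-comm-last : ∀ m t R x → x ≤ m → Cl' (suc m) (Cr' (suc m) (t , R) x) m ≡ Cr' (suc m) (Cl' (suc m) (t , R) m) x
Cl'-Cr'-comm-last m t R x x≤m = begin
  Cl' (suc m) (Cr' (suc m) (t , R) x) m
    ≡⟨ cong (λ u → Cl' (suc m) u m) (Cr'-suc m t R x) ⟩
  Cl' (suc m) (Cr'? m t k , R₁) m
    ≡⟨ Cl'-suc-diag m (Cr'? m t k) R₁ ⟩
  proj₁ (sweep m (Cr'? m t k) nothing) , incAt (fromMaybe m (proj₂ (sweep m (Cr'? m t k) nothing))) R₁
    ≡⟨ cong (λ (u , s′) → u , incAt (fromMaybe m s′) R₁) (sweep-Cr'? m t k (crLastRow-bound m R x x≤m)) ⟩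
  Cr'? m t₁ (s ⊔∞ k) , incAt (fromMaybe m (s ⊓∞ k)) R₁
    ≡⟨ cong (λ (k′ , R′) → Cr'? m t₁ k′ , R′) (clLastRow-crLastRow-comm m R x s x≤m (sweep-bound m t)) ⟩
  Cr'? m t₁ (proj₂ (crLastRow m R₂ x)) , proj₁ (crLastRow m R₂ x)
    ≡⟨ Cr'-suc m t₁ R₂ x ⟨
  Cr' (suc m) (t₁ , R₂) x
    ≡⟨ cong (λ u → Cr' (suc m) u x) (Cl'-suc-diag m t R) ⟨
  Cr' (suc m) (Cl' (suc m) (t , R) m) x
    ∎
  where
  R₁ = proj₁ (crLastRow m R x)
  k  = proj₂ (crLastRow m R x)
  t₁ = proj₁ (sweep m t nothing)
  s  = proj₂ (sweep m t nothing)
  R₂ = incAt (fromMaybe m s) R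

Cl'-Cr'-comm : ∀ n t x y → x < n → y < n → Cl' n (Cr' n t x) y ≡ Cr' n (Cl' n t y) x
Cl'-Cr'-comm (suc m) (t , R) x y x<n y<n = byRow (y ≟ m)
  where
  byRow : Dec (y ≡ m) → Cl' (suc m) (Cr' (suc m) (t , R) x) y ≡ Cr' (suc m) (Cl' (suc m) (t , R) y) x
  byRow (yes refl) = Cl'-Cr'-comm-last m t R x (≤-pred x<n)
  byRow (no y≢m)   = Cl'-Cr'-comm-below m t R x y (≤-pred x<n) y≢m
                       (λ x′ x′<m → Cl'-Cr'-comm m t x′ y x′<m (≤∧≢⇒< (≤-pred y<n) y≢m))

mainTheorem9 : (n : ℕ) → n ≥ 1 → (t : Stair n) → (x y : Fin n) →
    Cl (Cr t x) y ≡ Cr (Cl t y) x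
mainTheorem9 n _ t x y = Cl'-Cr'-comm n t (toℕ x) (toℕ y) (toℕ<n x) (toℕ<n y)
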